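{- Let $E$ be a finite set and let $\mathcal E$ be a non-empty collection of subsets of $E$ which is closed downwards (if $A\in\mathcal E$ and $B\subset A$ then $B\in\mathcal E$). Suppose that every maximal member of $\mathcal E$ has size at least $r$, for some $r\in\mathbb{N}$. Let $R$ be chosen uniformly at random from $\mathcal E$. Then $|R|$ is stochastically at least ${\rm Bin}(r,\tfrac12)$, i.e. $\mathbb{P}(|R|\ge t)\ge\mathbb{P}(Y\ge t)$ for all $t$, where $Y\sim{\rm Bin}(r,\tfrac12)$.
   Context: ${\rm Bin}(r,p)$ denotes the binomial distribution. -}

module Defs where

open import Data.Nat using (ℕ; zero; suc; _≤?_; _≤_)
open import Data.Nat.Combinatorics using (_C_)
open import Data.Bool using (true; false)
open import Data.Vec using ([]; _∷_)
open import Data.List using (List; []; _∷_; map; _++_; filter; length; upTo)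
open import Data.Nat.ListAction using (sum)
open import Data.Fin.Subset using (Subset; _⊂_; ∣_∣)
open import Data.Product using (_×_)
open import Relation.Nullary using (¬_)
open import Relation.Unary using (Pred; Decidable)
open import Relation.Nullary.Decidable using (_×-dec_)
open import Level using (0ℓ)

allSubsets : (n : ℕ) → List (Subset n)
allSubsets zero = [] ∷ []
allSubsets (suc n) = map (true ∷_) (allSubsets n) ++ map (false ∷_) (allSubsets n)

card : ∀ {n} {𝓔 : Pred (Subset n) 0ℓ} → Decidable 𝓔 → ℕ
card {n} 𝓔? = length (filter 𝓔? (allSubsets n))

cardAtLeast : ∀ {n} {𝓔 : Pred (Subset n) 0ℓ} → Decidable 𝓔 → ℕ → ℕ
cardAtLeast {n} 𝓔? t = length (filter (λ A → 𝓔? A ×-dec (t ≤? ∣ A ∣)) (allSubsets n))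

-- Σ_{k=t}^{r} C(r,k)  ( = 2^r · P(Bin(r,1/2) ≥ t) )
binomTail : ℕ → ℕ → ℕ
binomTail r t = sum (map (r C_) (filter (t ≤?_) (upTo (suc r))))

DownClosed : ∀ {n} → Pred (Subset n) 0ℓ → Set
DownClosed 𝓔 = ∀ A B → B Data.Fin.Subset.⊆ A → 𝓔 A → 𝓔 B

Maximal : ∀ {n} → Pred (Subset n) 0ℓ → Subset n → Set
Maximal 𝓔 A = 𝓔 A × (∀ B → 𝓔 B → ¬ (A ⊂ B))

module Submission where

-- Let a k be the number of members of 𝓔 of size k. Each member p extends to a maximal
-- member, of size at least r, so p has at least r ∸ ∣ p ∣ one-point extensions in 𝓔;
-- conversely a member of size k + 1 arises from exactly k + 1 sets by removing a point,
-- all of them in 𝓔 by down-closure. Double counting gives (r ∸ k) a k ≤ (k + 1) a (k + 1),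
-- which by the absorption identity (k + 1) (r C (k + 1)) = (r ∸ k) (r C k) says that
-- a k / r C k is non-decreasing in k.
-- A sequence whose ratio to the weights r C k increases puts at least the same fraction
-- of its mass on {k ≥ t} as Bin(r, 1/2) does, by Chebyshev's sum inequality.

open import Data.Bool using (Bool; true; false; not; _∧_)
import Data.Bool.Properties as Bool
open import Data.Fin using (Fin; zero; suc; _≟_)
open import Data.Fin.Properties using (any?)
open import Data.Fin.Subset using (Subset; ∣_∣; _⊆_; _∈_; _∉_; inside; outside)
open import Data.Fin.Subset.Properties using (∣p∣≤n)
open import Data.List using (List; []; _∷_; map; _++_; filter; length; upTo; allFin)
open import Data.List.Properties using (map-applyUpTo; map-upTo; map-tabulate)
open import Data.Nat
  using (ℕ; zero; suc; _+_; _*_; _∸_; _^_; _≤_; _<_; _≤′_; ≤′-refl; ≤′-step; z≤n; s≤s; _≡ᵇ_; _≤ᵇ_; _≤?_; >-nonZero)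
open import Data.Nat.Combinatorics using (_C_; nC1≡n; nCk+nC[k+1]≡[n+1]C[k+1]; k>n⇒nCk≡0)
open import Data.Nat.ListAction using (sum)
open import Data.Nat.Properties hiding (_≟_)
open import Data.Nat.Tactic.RingSolver using (solve-∀)
open import Data.Product using (∃; ∃-syntax; _×_; _,_)
open import Data.Vec using ([]; _∷_; lookup; _[_]≔_)
open import Data.Vec.Properties
  using ([]=⇒lookup; lookup⇒[]=; lookup∘update; lookup∘update′; []≔-idempotent; []≔-lookup)
open import Function using (id; _∘_)
open import Level using (Level; 0ℓ)
open import Relation.Binary.PropositionalEquality
open import Relation.Nullary using (does; yes; no; contradiction)
open import Relation.Nullary.Decidable using (_×-dec_)
open import Relation.Nullary.Reflects using (ofʸ; ofⁿ)
open import Relation.Unary using (Pred; Decidable)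

open import Defs

-- Finite sums

private variable
  ℓ : Level
  X Y : Set

∑ : List X → (X → ℕ) → ℕ
∑ xs f = sum (map f xs)

∑-++ : ∀ (xs ys : List X) f → ∑ (xs ++ ys) f ≡ ∑ xs f + ∑ ys f
∑-++ []       ys f = refl
∑-++ (x ∷ xs) ys f = trans (cong (f x +_) (∑-++ xs ys f)) (sym (+-assoc (f x) (∑ xs f) (∑ ys f)))

∑-map : ∀ (g : X → Y) xs f → ∑ (map g xs) f ≡ ∑ xs (f ∘ g)
∑-map g []       f = refl
∑-map g (x ∷ xs) f = cong (f (g x) +_) (∑-map g xs f)

∑-cong : ∀ (xs : List X) {f g} → (∀ x → f x ≡ g x) → ∑ xs f ≡ ∑ xs g
∑-cong []       f≗g = refl
∑-cong (x ∷ xs) f≗g = cong₂ _+_ (f≗g x) (∑-cong xs f≗g)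

∑-mono : ∀ (xs : List X) {f g} → (∀ x → f x ≤ g x) → ∑ xs f ≤ ∑ xs g
∑-mono []       f≤g = z≤n
∑-mono (x ∷ xs) f≤g = +-mono-≤ (f≤g x) (∑-mono xs f≤g)

∑-zero : ∀ (xs : List X) → ∑ xs (λ _ → 0) ≡ 0
∑-zero []       = refl
∑-zero (x ∷ xs) = ∑-zero xs

∑-+ : ∀ (xs : List X) f g → ∑ xs (λ x → f x + g x) ≡ ∑ xs f + ∑ xs g
∑-+ []       f g = refl
∑-+ (x ∷ xs) f g = trans (cong (f x + g x +_) (∑-+ xs f g)) (+-interchange (f x) (g x) (∑ xs f) (∑ xs g))
  where
  +-interchange : ∀ a b c d → a + b + (c + d) ≡ a + c + (b + d)
  +-interchange = solve-∀

∑-*ˡ : ∀ (xs : List X) c f → ∑ xs (λ x → c * f x) ≡ c * ∑ xs f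
∑-*ˡ []       c f = sym (*-zeroʳ c)
∑-*ˡ (x ∷ xs) c f = trans (cong (c * f x +_) (∑-*ˡ xs c f)) (sym (*-distribˡ-+ c (f x) (∑ xs f)))

∑-*ʳ : ∀ (xs : List X) f c → ∑ xs (λ x → f x * c) ≡ ∑ xs f * c
∑-*ʳ xs f c = trans (∑-cong xs (λ x → *-comm (f x) c)) (trans (∑-*ˡ xs c f) (*-comm c (∑ xs f)))

∑-comm : ∀ (xs : List X) (ys : List Y) (f : X → Y → ℕ) →
         ∑ xs (λ x → ∑ ys (f x)) ≡ ∑ ys (λ y → ∑ xs (λ x → f x y))
∑-comm []       ys f = sym (∑-zero ys)
∑-comm (x ∷ xs) ys f =
  trans (cong (∑ ys (f x) +_) (∑-comm xs ys f)) (sym (∑-+ ys (f x) (λ y → ∑ xs (λ x → f x y))))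

∑-*-∑ : ∀ (xs : List X) (ys : List Y) (f : X → ℕ) (g : Y → ℕ) →
        ∑ xs f * ∑ ys g ≡ ∑ xs (λ x → ∑ ys (λ y → f x * g y))
∑-*-∑ []       ys f g = refl
∑-*-∑ (x ∷ xs) ys f g = begin
  (f x + ∑ xs f) * ∑ ys g           ≡⟨ *-distribʳ-+ (∑ ys g) (f x) (∑ xs f) ⟩
  f x * ∑ ys g + ∑ xs f * ∑ ys g    ≡⟨ cong₂ _+_ (sym (∑-*ˡ ys (f x) g)) (∑-*-∑ xs ys f g) ⟩
  ∑ (x ∷ xs) (λ x → ∑ ys (λ y → f x * g y)) ∎
  where open ≡-Reasoning

𝟙 : Bool → ℕ
𝟙 true  = 1
𝟙 false = 0

𝟙-∧ : ∀ b c → 𝟙 (b ∧ c) ≡ 𝟙 b * 𝟙 c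
𝟙-∧ true  c = sym (+-identityʳ (𝟙 c))
𝟙-∧ false c = refl

𝟙-split : ∀ b x → x ≡ 𝟙 b * x + 𝟙 (not b) * x
𝟙-split true  x = trans (sym (+-identityʳ x)) (cong (_+ 0) (sym (+-identityʳ x)))
𝟙-split false x = sym (+-identityʳ x)

length-filter : ∀ {P : Pred X ℓ} (P? : Decidable P) xs →
                length (filter P? xs) ≡ ∑ xs (λ x → 𝟙 (does (P? x)))
length-filter P? []       = refl
length-filter P? (x ∷ xs) with does (P? x)
... | true  = cong suc (length-filter P? xs)
... | false = length-filter P? xs

∑-filter : ∀ {P : Pred X ℓ} (P? : Decidable P) xs f →
           ∑ (filter P? xs) f ≡ ∑ xs (λ x → 𝟙 (does (P? x)) * f x)
∑-filter P? []       f = refl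
∑-filter P? (x ∷ xs) f with does (P? x)
... | true  = cong₂ _+_ (sym (+-identityʳ (f x))) (∑-filter P? xs f)
... | false = ∑-filter P? xs f

∑-upTo-suc : ∀ m f → ∑ (upTo (suc m)) f ≡ f 0 + ∑ (upTo m) (f ∘ suc)
∑-upTo-suc m f = cong (λ xs → f 0 + sum xs)
  (trans (map-applyUpTo suc f m) (sym (map-upTo (f ∘ suc) m)))

∑-allFin-suc : ∀ n (f : Fin (suc n) → ℕ) → ∑ (allFin (suc n)) f ≡ f zero + ∑ (allFin n) (f ∘ suc)
∑-allFin-suc n f = cong (λ xs → f zero + sum xs)
  (trans (map-tabulate suc f) (sym (map-tabulate id (f ∘ suc))))

∑-upTo-≡ᵇ : ∀ {s N} g → s < N → ∑ (upTo N) (λ k → 𝟙 (s ≡ᵇ k) * g k) ≡ g s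
∑-upTo-≡ᵇ {zero}  {suc N} g _ = begin
  ∑ (upTo (suc N)) (λ k → 𝟙 (0 ≡ᵇ k) * g k) ≡⟨ ∑-upTo-suc N (λ k → 𝟙 (0 ≡ᵇ k) * g k) ⟩
  g 0 + 0 + ∑ (upTo N) (λ _ → 0)            ≡⟨ cong₂ _+_ (+-identityʳ (g 0)) (∑-zero (upTo N)) ⟩
  g 0 + 0                                   ≡⟨ +-identityʳ (g 0) ⟩
  g 0 ∎
  where open ≡-Reasoning
∑-upTo-≡ᵇ {suc s} {suc N} g (s≤s s<N) =
  trans (∑-upTo-suc N (λ k → 𝟙 (suc s ≡ᵇ k) * g k)) (∑-upTo-≡ᵇ (λ k → g (suc k)) s<N)

∑-upTo-vanishing : ∀ {m N} f → (∀ k → m ≤ k → f k ≡ 0) → m ≤ N → ∑ (upTo N) f ≡ ∑ (upTo m) f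
∑-upTo-vanishing {zero}  {N}     f f≡0 _ = trans (∑-cong (upTo N) (λ k → f≡0 k z≤n)) (∑-zero (upTo N))
∑-upTo-vanishing {suc m} {suc N} f f≡0 (s≤s m≤N) = begin
  ∑ (upTo (suc N)) f            ≡⟨ ∑-upTo-suc N f ⟩
  f 0 + ∑ (upTo N) (f ∘ suc)    ≡⟨ cong (f 0 +_) (∑-upTo-vanishing (f ∘ suc) (λ k → f≡0 (suc k) ∘ s≤s) m≤N) ⟩
  f 0 + ∑ (upTo m) (f ∘ suc)    ≡⟨ sym (∑-upTo-suc m f) ⟩
  ∑ (upTo (suc m)) f ∎
  where open ≡-Reasoning

-- Binomial coefficients

pascal : ∀ r k → suc r C suc k ≡ r C k + r C suc k
pascal r k = sym (nCk+nC[k+1]≡[n+1]C[k+1] r k)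

-- Stated with both sides moved so that no subtraction occurs; see absorption′.
absorption : ∀ r k → suc k * (r C suc k) + k * (r C k) ≡ r * (r C k)
absorption zero    zero    = refl
absorption zero    (suc k) = cong₂ _+_ (*-zeroʳ (suc (suc k))) (*-zeroʳ (suc k))
absorption (suc r) zero    = begin
  1 * (suc r C 1) + 0 ≡⟨ trans (+-identityʳ _) (*-identityˡ _) ⟩
  suc r C 1           ≡⟨ nC1≡n (suc r) ⟩
  suc r               ≡⟨ sym (*-identityʳ (suc r)) ⟩
  suc r * 1 ∎
  where open ≡-Reasoning
absorption (suc r) (suc k) = begin
  suc (suc k) * (suc r C suc (suc k)) + suc k * (suc r C suc k)
    ≡⟨ cong₂ (λ u v → suc (suc k) * u + suc k * v) (pascal r (suc k)) (pascal r k) ⟩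
  suc (suc k) * (c₁ + c₂) + suc k * (c₀ + c₁)
    ≡⟨ regroup k c₀ c₁ c₂ ⟩
  (suc (suc k) * c₂ + suc k * c₁) + (c₁ + c₀) + (suc k * c₁ + k * c₀)
    ≡⟨ cong₂ (λ u v → u + (c₁ + c₀) + v) (absorption r (suc k)) (absorption r k) ⟩
  r * c₁ + (c₁ + c₀) + r * c₀
    ≡⟨ collect r c₀ c₁ ⟩
  suc r * (c₀ + c₁)
    ≡⟨ cong (suc r *_) (sym (pascal r k)) ⟩
  suc r * (suc r C suc k) ∎
  where
  open ≡-Reasoning
  c₀ = r C k
  c₁ = r C suc k
  c₂ = r C suc (suc k)
  regroup : ∀ k c₀ c₁ c₂ → suc (suc k) * (c₁ + c₂) + suc k * (c₀ + c₁)
                        ≡ (suc (suc k) * c₂ + suc k * c₁) + (c₁ + c₀) + (suc k * c₁ + k * c₀)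
  regroup = solve-∀
  collect : ∀ r c₀ c₁ → r * c₁ + (c₁ + c₀) + r * c₀ ≡ suc r * (c₀ + c₁)
  collect = solve-∀

absorption′ : ∀ r k → suc k * (r C suc k) ≡ (r ∸ k) * (r C k)
absorption′ r k = begin
  suc k * (r C suc k)                                ≡⟨ sym (m+n∸n≡m _ (k * (r C k))) ⟩
  suc k * (r C suc k) + k * (r C k) ∸ k * (r C k)    ≡⟨ cong (_∸ k * (r C k)) (absorption r k) ⟩
  r * (r C k) ∸ k * (r C k)                          ≡⟨ sym (*-distribʳ-∸ (r C k) r k) ⟩
  (r ∸ k) * (r C k) ∎
  where open ≡-Reasoning

nCk>0 : ∀ {n k} → k ≤ n → 0 < n C k
nCk>0 {n}     {zero}  _         = s≤s z≤n
nCk>0 {suc n} {suc k} (s≤s k≤n) =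
  ≤-trans (nCk>0 k≤n) (subst (n C k ≤_) (sym (pascal n k)) (m≤m+n (n C k) (n C suc k)))

∑-binomial : ∀ {r N} → r < N → ∑ (upTo N) (r C_) ≡ 2 ^ r
∑-binomial {zero}  {suc N} _ =
  trans (∑-upTo-suc N (0 C_)) (cong suc (∑-zero (upTo N)))
∑-binomial {suc r} {suc N} (s≤s r<N) = begin
  ∑ (upTo (suc N)) (suc r C_)                              ≡⟨ ∑-upTo-suc N (suc r C_) ⟩
  1 + ∑ (upTo N) (λ k → suc r C suc k)                     ≡⟨ cong (1 +_) (∑-cong (upTo N) (pascal r)) ⟩
  1 + ∑ (upTo N) (λ k → r C k + r C suc k)                 ≡⟨ cong (1 +_) (∑-+ (upTo N) (r C_) (λ k → r C suc k)) ⟩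
  1 + (∑ (upTo N) (r C_) + ∑ (upTo N) (λ k → r C suc k))   ≡⟨ +-comm-under-1 _ _ ⟩
  ∑ (upTo N) (r C_) + (1 + ∑ (upTo N) (λ k → r C suc k))   ≡⟨ cong (∑ (upTo N) (r C_) +_) (sym (∑-upTo-suc N (r C_))) ⟩
  ∑ (upTo N) (r C_) + ∑ (upTo (suc N)) (r C_)              ≡⟨ cong₂ _+_ (∑-binomial r<N) (∑-binomial (m≤n⇒m≤1+n r<N)) ⟩
  2 ^ r + 2 ^ r                                            ≡⟨ cong (2 ^ r +_) (sym (+-identityʳ (2 ^ r))) ⟩
  2 ^ suc r ∎
  where
  open ≡-Reasoning
  +-comm-under-1 : ∀ a b → 1 + (a + b) ≡ a + (1 + b)
  +-comm-under-1 = solve-∀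

module _ (r : ℕ) (a : ℕ → ℕ) (step : ∀ k → (r ∸ k) * a k ≤ suc k * a (suc k)) where

  ratio-≤-suc : ∀ k → a k * (r C suc k) ≤ a (suc k) * (r C k)
  ratio-≤-suc k = *-cancelˡ-≤ (suc k) (begin
    suc k * (a k * (r C suc k))   ≡⟨ x*[y*z]≡y*[x*z] (suc k) (a k) _ ⟩
    a k * (suc k * (r C suc k))   ≡⟨ cong (a k *_) (absorption′ r k) ⟩
    a k * ((r ∸ k) * (r C k))     ≡⟨ sym (*-assoc (a k) (r ∸ k) _) ⟩
    a k * (r ∸ k) * (r C k)       ≡⟨ cong (_* (r C k)) (*-comm (a k) (r ∸ k)) ⟩
    (r ∸ k) * a k * (r C k)       ≤⟨ *-monoˡ-≤ (r C k) (step k) ⟩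
    suc k * a (suc k) * (r C k)   ≡⟨ *-assoc (suc k) (a (suc k)) _ ⟩
    suc k * (a (suc k) * (r C k)) ∎)
    where
    open ≤-Reasoning
    x*[y*z]≡y*[x*z] : ∀ x y z → x * (y * z) ≡ y * (x * z)
    x*[y*z]≡y*[x*z] = solve-∀

  -- The ratio a k / r C k is non-decreasing; cross-multiplied since r C k vanishes for k > r.
  ratio-mono : ∀ {k j} → k ≤ j → a k * (r C j) ≤ a j * (r C k)
  ratio-mono k≤j = go (≤⇒≤′ k≤j)
    where
    go : ∀ {k j} → k ≤′ j → a k * (r C j) ≤ a j * (r C k)
    go ≤′-refl = ≤-refl
    go {k} {suc j} (≤′-step k≤j) with j ≤? r
    ... | no  j≰r = subst (_≤ a (suc j) * (r C k))
                      (sym (trans (cong (a k *_) (k>n⇒nCk≡0 (m<n⇒m<1+n (≰⇒> j≰r)))) (*-zeroʳ (a k)))) z≤n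
    ... | yes j≤r = *-cancelˡ-≤ (r C j) {{>-nonZero (nCk>0 j≤r)}} (begin
      (r C j) * (a k * (r C suc j))     ≡⟨ rotate (r C j) (a k) _ ⟩
      (r C suc j) * (a k * (r C j))     ≤⟨ *-monoʳ-≤ (r C suc j) (go k≤j) ⟩
      (r C suc j) * (a j * (r C k))     ≡⟨ rotate (r C suc j) (a j) _ ⟩
      (r C k) * (a j * (r C suc j))     ≤⟨ *-monoʳ-≤ (r C k) (ratio-≤-suc j) ⟩
      (r C k) * (a (suc j) * (r C j))   ≡⟨ rotate (r C k) (a (suc j)) _ ⟩
      (r C j) * (a (suc j) * (r C k))   ∎)
      where
      open ≤-Reasoning
      rotate : ∀ x y z → x * (y * z) ≡ z * (y * x)
      rotate = solve-∀

module _ (a c : ℕ → ℕ) (mono : ∀ {k j} → k ≤ j → a k * c j ≤ a j * c k) (t : ℕ) where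

  private
    u ū : ℕ → ℕ
    u k = 𝟙 (t ≤ᵇ k)
    ū k = 𝟙 (not (t ≤ᵇ k))

    ∑∑ : List ℕ → (ℕ → ℕ → ℕ) → ℕ
    ∑∑ xs f = ∑ xs (λ k → ∑ xs (f k))

    ∑∑-+ : ∀ xs f g → ∑∑ xs (λ k j → f k j + g k j) ≡ ∑∑ xs f + ∑∑ xs g
    ∑∑-+ xs f g = trans (∑-cong xs (λ k → ∑-+ xs (f k) (g k))) (∑-+ xs _ _)

    ∑∑-cong : ∀ xs {f g} → (∀ k j → f k j ≡ g k j) → ∑∑ xs f ≡ ∑∑ xs g
    ∑∑-cong xs f≗g = ∑-cong xs (λ k → ∑-cong xs (f≗g k))

    crossing : ∀ k j → ū k * (u j * (a k * c j)) ≤ ū k * (u j * (a j * c k))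
    crossing k j with t ≤ᵇ k | ≤ᵇ-reflects-≤ t k | t ≤ᵇ j | ≤ᵇ-reflects-≤ t j
    ... | true  | _        | _     | _        = z≤n
    ... | false | _        | false | _        = z≤n
    ... | false | ofⁿ t≰k  | true  | ofʸ t≤j  =
      *-monoʳ-≤ 1 (*-monoʳ-≤ 1 (mono (≤-trans (<⇒≤ (≰⇒> t≰k)) t≤j)))

  -- Chebyshev's sum inequality in the form needed: pairs k < t ≤ j are traded for pairs j < t ≤ k.
  tail-comparison : ∀ xs → ∑ xs a * ∑ xs (λ j → 𝟙 (t ≤ᵇ j) * c j) ≤ ∑ xs (λ k → 𝟙 (t ≤ᵇ k) * a k) * ∑ xs c
  tail-comparison xs = begin
    ∑ xs a * ∑ xs (λ j → u j * c j)
      ≡⟨ ∑-*-∑ xs xs a (λ j → u j * c j) ⟩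
    ∑∑ xs (λ k j → a k * (u j * c j))
      ≡⟨ ∑∑-cong xs (λ k j → trans (x*[y*z]≡y*[x*z] (a k) (u j) (c j)) (𝟙-split (t ≤ᵇ k) _)) ⟩
    ∑∑ xs (λ k j → u k * (u j * (a k * c j)) + ū k * (u j * (a k * c j)))
      ≡⟨ ∑∑-+ xs _ _ ⟩
    ∑∑ xs (λ k j → u k * (u j * (a k * c j))) + ∑∑ xs (λ k j → ū k * (u j * (a k * c j)))
      ≤⟨ +-monoʳ-≤ _ (∑-mono xs (λ k → ∑-mono xs (crossing k))) ⟩
    ∑∑ xs (λ k j → u k * (u j * (a k * c j))) + ∑∑ xs (λ k j → ū k * (u j * (a j * c k)))
      ≡⟨ cong (∑∑ xs (λ k j → u k * (u j * (a k * c j))) +_) (∑-comm xs xs _) ⟩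
    ∑∑ xs (λ k j → u k * (u j * (a k * c j))) + ∑∑ xs (λ k j → ū j * (u k * (a k * c j)))
      ≡⟨ sym (∑∑-+ xs _ _) ⟩
    ∑∑ xs (λ k j → u k * (u j * (a k * c j)) + ū j * (u k * (a k * c j)))
      ≡⟨ ∑∑-cong xs (λ k j → trans (cong (_+ ū j * (u k * (a k * c j))) (x*[y*z]≡y*[x*z] (u k) (u j) _))
                                    (sym (𝟙-split (t ≤ᵇ j) _))) ⟩
    ∑∑ xs (λ k j → u k * (a k * c j))
      ≡⟨ ∑∑-cong xs (λ k j → sym (*-assoc (u k) (a k) (c j))) ⟩
    ∑∑ xs (λ k j → u k * a k * c j)
      ≡⟨ sym (∑-*-∑ xs xs (λ k → u k * a k) c) ⟩
    ∑ xs (λ k → u k * a k) * ∑ xs c ∎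
    where
    open ≤-Reasoning
    x*[y*z]≡y*[x*z] : ∀ x y z → x * (y * z) ≡ y * (x * z)
    x*[y*z]≡y*[x*z] = solve-∀

-- Subsets of Fin n

∣p∣≡∑ : ∀ {n} (p : Subset n) → ∣ p ∣ ≡ ∑ (allFin n) (λ x → 𝟙 (lookup p x))
∣p∣≡∑ []            = refl
∣p∣≡∑ (inside  ∷ p) = trans (cong suc (∣p∣≡∑ p)) (sym (∑-allFin-suc _ (λ x → 𝟙 (lookup (inside ∷ p) x))))
∣p∣≡∑ (outside ∷ p) = trans (∣p∣≡∑ p) (sym (∑-allFin-suc _ (λ x → 𝟙 (lookup (outside ∷ p) x))))

∣p[x]≔inside∣≡1+∣p∣ : ∀ {n} (p : Subset n) x → lookup p x ≡ outside → ∣ p [ x ]≔ inside ∣ ≡ suc ∣ p ∣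
∣p[x]≔inside∣≡1+∣p∣ (_       ∷ p) zero    refl = refl
∣p[x]≔inside∣≡1+∣p∣ (inside  ∷ p) (suc x) px   = cong suc (∣p[x]≔inside∣≡1+∣p∣ p x px)
∣p[x]≔inside∣≡1+∣p∣ (outside ∷ p) (suc x) px   = ∣p[x]≔inside∣≡1+∣p∣ p x px

p[x]≔outside[x]≔inside≡p : ∀ {n} (p : Subset n) x → lookup p x ≡ inside →
                           (p [ x ]≔ outside) [ x ]≔ inside ≡ p
p[x]≔outside[x]≔inside≡p p x px =
  trans ([]≔-idempotent p x) (trans (cong (p [ x ]≔_) (sym px)) ([]≔-lookup p x))

∣p∣≡1+∣p[x]≔outside∣ : ∀ {n} (p : Subset n) x → lookup p x ≡ inside → ∣ p ∣ ≡ suc ∣ p [ x ]≔ outside ∣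
∣p∣≡1+∣p[x]≔outside∣ p x px = begin
  ∣ p ∣                                   ≡⟨ cong ∣_∣ (sym (p[x]≔outside[x]≔inside≡p p x px)) ⟩
  ∣ (p [ x ]≔ outside) [ x ]≔ inside ∣    ≡⟨ ∣p[x]≔inside∣≡1+∣p∣ (p [ x ]≔ outside) x (lookup∘update x p outside) ⟩
  suc ∣ p [ x ]≔ outside ∣ ∎
  where open ≡-Reasoning

module _ {n} {p : Subset n} {x : Fin n} where

  p⊆p[x]≔inside : p ⊆ p [ x ]≔ inside
  p⊆p[x]≔inside {y} y∈p with y ≟ x
  ... | yes refl = lookup⇒[]= x _ (lookup∘update x p inside)
  ... | no  y≢x  = lookup⇒[]= y _ (trans (lookup∘update′ y≢x p inside) ([]=⇒lookup y∈p))

  p[x]≔outside⊆p : p [ x ]≔ outside ⊆ p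
  p[x]≔outside⊆p {y} y∈p′ with y ≟ x
  ... | yes refl with () ← trans (sym (lookup∘update x p outside)) ([]=⇒lookup y∈p′)
  ... | no  y≢x  = lookup⇒[]= y p (trans (sym (lookup∘update′ y≢x p outside)) ([]=⇒lookup y∈p′))

  p[x]≔inside⊆q : ∀ {q} → p ⊆ q → x ∈ q → p [ x ]≔ inside ⊆ q
  p[x]≔inside⊆q p⊆q x∈q {y} y∈p′ with y ≟ x
  ... | yes refl = x∈q
  ... | no  y≢x  = p⊆q (lookup⇒[]= y p (trans (sym (lookup∘update′ y≢x p inside)) ([]=⇒lookup y∈p′)))

∑-allSubsets-suc : ∀ n (f : Subset (suc n) → ℕ) →
  ∑ (allSubsets (suc n)) f ≡ ∑ (allSubsets n) (λ p → f (inside ∷ p)) + ∑ (allSubsets n) (λ p → f (outside ∷ p))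
∑-allSubsets-suc n f = trans (∑-++ (map (inside ∷_) (allSubsets n)) _ f)
  (cong₂ _+_ (∑-map (inside ∷_) (allSubsets n) f) (∑-map (outside ∷_) (allSubsets n) f))

-- Reindexing along the bijection p ↦ p [ x ]≔ inside from the subsets avoiding x to those containing x.
∑-allSubsets-flip : ∀ {n} (x : Fin n) (f : Subset n → ℕ) →
  ∑ (allSubsets n) (λ p → 𝟙 (not (lookup p x)) * f p) ≡ ∑ (allSubsets n) (λ q → 𝟙 (lookup q x) * f (q [ x ]≔ outside))
∑-allSubsets-flip {suc n} zero f = begin
  ∑ (allSubsets (suc n)) (λ p → 𝟙 (not (lookup p zero)) * f p)
    ≡⟨ ∑-allSubsets-suc n _ ⟩
  ∑ L (λ _ → 0) + ∑ L (λ p → 1 * f (outside ∷ p))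
    ≡⟨ cong (_+ ∑ L (λ p → 1 * f (outside ∷ p))) (∑-zero L) ⟩
  ∑ L (λ p → 1 * f (outside ∷ p))
    ≡⟨ sym (trans (cong (∑ L (λ p → 1 * f (outside ∷ p)) +_) (∑-zero L)) (+-identityʳ _)) ⟩
  ∑ L (λ q → 1 * f (outside ∷ q)) + ∑ L (λ _ → 0)
    ≡⟨ sym (∑-allSubsets-suc n _) ⟩
  ∑ (allSubsets (suc n)) (λ q → 𝟙 (lookup q zero) * f (q [ zero ]≔ outside)) ∎
  where
  open ≡-Reasoning
  L = allSubsets n
∑-allSubsets-flip {suc n} (suc x) f = begin
  ∑ (allSubsets (suc n)) (λ p → 𝟙 (not (lookup p (suc x))) * f p)
    ≡⟨ ∑-allSubsets-suc n _ ⟩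
  ∑ L (λ p → 𝟙 (not (lookup p x)) * f (inside ∷ p)) + ∑ L (λ p → 𝟙 (not (lookup p x)) * f (outside ∷ p))
    ≡⟨ cong₂ _+_ (∑-allSubsets-flip x (λ p → f (inside ∷ p))) (∑-allSubsets-flip x (λ p → f (outside ∷ p))) ⟩
  ∑ L (λ q → 𝟙 (lookup q x) * f (inside ∷ (q [ x ]≔ outside)))
    + ∑ L (λ q → 𝟙 (lookup q x) * f (outside ∷ (q [ x ]≔ outside)))
    ≡⟨ sym (∑-allSubsets-suc n _) ⟩
  ∑ (allSubsets (suc n)) (λ q → 𝟙 (lookup q (suc x)) * f (q [ suc x ]≔ outside)) ∎
  where
  open ≡-Reasoning
  L = allSubsets n

∑-by-size : ∀ {n} N (w : Subset n → ℕ) (g : ℕ → ℕ) → n < N →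
  ∑ (allSubsets n) (λ p → g ∣ p ∣ * w p) ≡ ∑ (upTo N) (λ k → g k * ∑ (allSubsets n) (λ p → 𝟙 (∣ p ∣ ≡ᵇ k) * w p))
∑-by-size {n} N w g n<N = begin
  ∑ L (λ p → g ∣ p ∣ * w p)
    ≡⟨ ∑-cong L (λ p → sym (∑-upTo-≡ᵇ (λ k → g k * w p) (≤-<-trans (∣p∣≤n p) n<N))) ⟩
  ∑ L (λ p → ∑ (upTo N) (λ k → 𝟙 (∣ p ∣ ≡ᵇ k) * (g k * w p)))
    ≡⟨ ∑-comm L (upTo N) _ ⟩
  ∑ (upTo N) (λ k → ∑ L (λ p → 𝟙 (∣ p ∣ ≡ᵇ k) * (g k * w p)))
    ≡⟨ ∑-cong (upTo N) (λ k → trans (∑-cong L (λ p → x*[y*z]≡y*[x*z] (𝟙 (∣ p ∣ ≡ᵇ k)) (g k) (w p))) (∑-*ˡ L (g k) _)) ⟩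
  ∑ (upTo N) (λ k → g k * ∑ L (λ p → 𝟙 (∣ p ∣ ≡ᵇ k) * w p)) ∎
  where
  open ≡-Reasoning
  L = allSubsets n
  x*[y*z]≡y*[x*z] : ∀ x y z → x * (y * z) ≡ y * (x * z)
  x*[y*z]≡y*[x*z] = solve-∀

-- Down-closed families

∉⇒lookup≡outside : ∀ {n} {p : Subset n} {x} → x ∉ p → lookup p x ≡ outside
∉⇒lookup≡outside {p = p} {x} x∉p with lookup p x in px
... | inside  = contradiction (lookup⇒[]= x p px) x∉p
... | outside = refl

module DownClosedFamily {n} {𝓔 : Pred (Subset n) 0ℓ} (𝓔? : Decidable 𝓔) (down : DownClosed 𝓔) where

  χ : Subset n → ℕ
  χ p = 𝟙 (does (𝓔? p))

  χ≡1 : ∀ {p} → 𝓔 p → χ p ≡ 1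
  χ≡1 {p} p∈𝓔 with 𝓔? p
  ... | yes _   = refl
  ... | no  p∉𝓔 = contradiction p∈𝓔 p∉𝓔

  χ[p[x]≔outside]*χp≡χp : ∀ p x → χ (p [ x ]≔ outside) * χ p ≡ χ p
  χ[p[x]≔outside]*χp≡χp p x with 𝓔? p
  ... | no  _   = *-zeroʳ (χ (p [ x ]≔ outside))
  ... | yes p∈𝓔 = cong (_* 1) (χ≡1 (down p _ p[x]≔outside⊆p p∈𝓔))

  -- A member admitting no one-point extension in 𝓔 is maximal, since any proper superset
  -- in 𝓔 contains such an extension; the fuel bounds the number of extensions.
  extend-to-maximal : ∀ {p} → 𝓔 p → ∃[ m ] p ⊆ m × Maximal 𝓔 m
  extend-to-maximal p∈𝓔 = go n p∈𝓔 (m≤m+n n _)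
    where
    go : ∀ fuel {p} → 𝓔 p → n ≤ fuel + ∣ p ∣ → ∃[ m ] p ⊆ m × Maximal 𝓔 m
    go fuel {p} p∈𝓔 n≤ with any? (λ x → (lookup p x Bool.≟ outside) ×-dec 𝓔? (p [ x ]≔ inside))
    ... | no ¬extendable = p , id , p∈𝓔 , λ q q∈𝓔 (p⊆q , y , y∈q , y∉p) →
      ¬extendable (y , ∉⇒lookup≡outside y∉p , down q _ (p[x]≔inside⊆q p⊆q y∈q) q∈𝓔)
    go zero       {p} p∈𝓔 n≤ | yes (x , px , _) =
      contradiction n≤ (<⇒≱ (subst (_≤ n) (∣p[x]≔inside∣≡1+∣p∣ p x px) (∣p∣≤n (p [ x ]≔ inside))))
    go (suc fuel) {p} p∈𝓔 n≤ | yes (x , px , p+x∈𝓔)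
      with m , p+x⊆m , m-maximal ← go fuel p+x∈𝓔
             (subst (n ≤_) (trans (sym (+-suc fuel ∣ p ∣)) (cong (fuel +_) (sym (∣p[x]≔inside∣≡1+∣p∣ p x px)))) n≤)
      = m , (λ y∈p → p+x⊆m (p⊆p[x]≔inside y∈p)) , m-maximal

  upDegree : Subset n → ℕ
  upDegree p = ∑ (allFin n) (λ x → 𝟙 (not (lookup p x)) * χ (p [ x ]≔ inside))

  ∣m∣≤∣p∣+upDegree : ∀ {p m} → p ⊆ m → 𝓔 m → ∣ m ∣ ≤ ∣ p ∣ + upDegree p
  ∣m∣≤∣p∣+upDegree {p} {m} p⊆m m∈𝓔 = begin
    ∣ m ∣                                        ≡⟨ ∣p∣≡∑ m ⟩
    ∑ F (λ x → 𝟙 (lookup m x))                   ≤⟨ ∑-mono F pointwise ⟩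
    ∑ F (λ x → 𝟙 (lookup p x) + 𝟙 (not (lookup p x)) * χ (p [ x ]≔ inside))
                                                 ≡⟨ ∑-+ F _ _ ⟩
    ∑ F (λ x → 𝟙 (lookup p x)) + upDegree p      ≡⟨ cong (_+ upDegree p) (sym (∣p∣≡∑ p)) ⟩
    ∣ p ∣ + upDegree p ∎
    where
    open ≤-Reasoning
    F = allFin n
    pointwise : ∀ x → 𝟙 (lookup m x) ≤ 𝟙 (lookup p x) + 𝟙 (not (lookup p x)) * χ (p [ x ]≔ inside)
    pointwise x with lookup p x in px | lookup m x in mx
    ... | inside  | inside  = ≤-refl
    ... | _       | outside = z≤n
    ... | outside | inside  =
      ≤-reflexive (sym (trans (+-identityʳ (χ (p [ x ]≔ inside)))
                              (χ≡1 (down m _ (p[x]≔inside⊆q p⊆m (lookup⇒[]= x m mx)) m∈𝓔))))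

  layer : ℕ → Subset n → ℕ
  layer k p = 𝟙 (∣ p ∣ ≡ᵇ k) * χ p

  layerSize : ℕ → ℕ
  layerSize k = ∑ (allSubsets n) (layer k)

  -- Double counting the pairs (p, p ∪ {x}) with p ∈ 𝓔 of size k and p ∪ {x} ∈ 𝓔.
  ∑-layer*upDegree : ∀ k → ∑ (allSubsets n) (λ p → layer k p * upDegree p) ≡ suc k * layerSize (suc k)
  ∑-layer*upDegree k = begin
    ∑ L (λ p → layer k p * upDegree p)
      ≡⟨ ∑-cong L (λ p → trans (sym (∑-*ˡ F (layer k p) _)) (∑-cong F (λ x → x*[y*z]≡y*[x*z] (layer k p) (𝟙 (not (lookup p x))) (χ (p [ x ]≔ inside))))) ⟩
    ∑ L (λ p → ∑ F (λ x → 𝟙 (not (lookup p x)) * (layer k p * χ (p [ x ]≔ inside))))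
      ≡⟨ ∑-comm L F _ ⟩
    ∑ F (λ x → ∑ L (λ p → 𝟙 (not (lookup p x)) * (layer k p * χ (p [ x ]≔ inside))))
      ≡⟨ ∑-cong F (λ x → ∑-allSubsets-flip x (λ p → layer k p * χ (p [ x ]≔ inside))) ⟩
    ∑ F (λ x → ∑ L (λ q → 𝟙 (lookup q x) * (layer k (q [ x ]≔ outside) * χ ((q [ x ]≔ outside) [ x ]≔ inside))))
      ≡⟨ ∑-cong F (λ x → ∑-cong L (remove x)) ⟩
    ∑ F (λ x → ∑ L (λ q → 𝟙 (lookup q x) * layer (suc k) q))
      ≡⟨ ∑-comm F L _ ⟩
    ∑ L (λ q → ∑ F (λ x → 𝟙 (lookup q x) * layer (suc k) q))
      ≡⟨ ∑-cong L (λ q → trans (∑-*ʳ F _ (layer (suc k) q)) (cong (_* layer (suc k) q) (sym (∣p∣≡∑ q)))) ⟩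
    ∑ L (λ q → ∣ q ∣ * layer (suc k) q)
      ≡⟨ ∑-cong L size ⟩
    ∑ L (λ q → suc k * layer (suc k) q)
      ≡⟨ ∑-*ˡ L (suc k) (layer (suc k)) ⟩
    suc k * layerSize (suc k) ∎
    where
    open ≡-Reasoning
    L = allSubsets n
    F = allFin n
    x*[y*z]≡y*[x*z] : ∀ x y z → x * (y * z) ≡ y * (x * z)
    x*[y*z]≡y*[x*z] = solve-∀

    remove : ∀ x q → 𝟙 (lookup q x) * (layer k (q [ x ]≔ outside) * χ ((q [ x ]≔ outside) [ x ]≔ inside))
                   ≡ 𝟙 (lookup q x) * layer (suc k) q
    remove x q with lookup q x in qx
    ... | outside = refl
    ... | inside rewrite p[x]≔outside[x]≔inside≡p q x qx | ∣p∣≡1+∣p[x]≔outside∣ q x qx =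
      cong (_+ 0) (trans (*-assoc (𝟙 (∣ q [ x ]≔ outside ∣ ≡ᵇ k)) _ _)
                         (cong (𝟙 (∣ q [ x ]≔ outside ∣ ≡ᵇ k) *_) (χ[p[x]≔outside]*χp≡χp q x)))

    size : ∀ q → ∣ q ∣ * layer (suc k) q ≡ suc k * layer (suc k) q
    size q with ∣ q ∣ ≡ᵇ suc k | ≡ᵇ⇒≡ ∣ q ∣ (suc k)
    ... | false | _         = trans (*-zeroʳ ∣ q ∣) (sym (*-zeroʳ (suc k)))
    ... | true  | ∣q∣≡1+k   = cong (_* (1 * χ q)) (∣q∣≡1+k _)

  module _ {r} (maximal-large : ∀ m → Maximal 𝓔 m → r ≤ ∣ m ∣) where

    r∸∣p∣≤upDegree : ∀ {p} → 𝓔 p → r ∸ ∣ p ∣ ≤ upDegree p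
    r∸∣p∣≤upDegree {p} p∈𝓔 with m , p⊆m , m-maximal@(m∈𝓔 , _) ← extend-to-maximal p∈𝓔 =
      m≤n+o⇒m∸n≤o r ∣ p ∣ (≤-trans (maximal-large m m-maximal) (∣m∣≤∣p∣+upDegree p⊆m m∈𝓔))

    layerSize-step : ∀ k → (r ∸ k) * layerSize k ≤ suc k * layerSize (suc k)
    layerSize-step k = begin
      (r ∸ k) * layerSize k                     ≡⟨ sym (∑-*ˡ L (r ∸ k) (layer k)) ⟩
      ∑ L (λ p → (r ∸ k) * layer k p)           ≤⟨ ∑-mono L pointwise ⟩
      ∑ L (λ p → layer k p * upDegree p)        ≡⟨ ∑-layer*upDegree k ⟩
      suc k * layerSize (suc k) ∎
      where
      open ≤-Reasoning
      L = allSubsets n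
      pointwise : ∀ p → (r ∸ k) * layer k p ≤ layer k p * upDegree p
      pointwise p with ∣ p ∣ ≡ᵇ k | ≡ᵇ⇒≡ ∣ p ∣ k | 𝓔? p
      ... | false | _       | _       = ≤-reflexive (*-zeroʳ (r ∸ k))
      ... | true  | _       | no  _   = ≤-reflexive (*-zeroʳ (r ∸ k))
      ... | true  | ∣p∣≡k   | yes p∈𝓔 = begin
        (r ∸ k) * 1      ≡⟨ *-identityʳ (r ∸ k) ⟩
        r ∸ k            ≡⟨ cong (r ∸_) (sym (∣p∣≡k _)) ⟩
        r ∸ ∣ p ∣        ≤⟨ r∸∣p∣≤upDegree p∈𝓔 ⟩
        upDegree p       ≡⟨ sym (+-identityʳ (upDegree p)) ⟩
        1 * upDegree p ∎

  card≡∑layerSize : ∀ {N} → n < N → card 𝓔? ≡ ∑ (upTo N) layerSize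
  card≡∑layerSize {N} n<N = begin
    card 𝓔?                                   ≡⟨ length-filter 𝓔? L ⟩
    ∑ L χ                                     ≡⟨ ∑-cong L (λ p → sym (*-identityˡ (χ p))) ⟩
    ∑ L (λ p → 1 * χ p)                       ≡⟨ ∑-by-size N χ (λ _ → 1) n<N ⟩
    ∑ (upTo N) (λ k → 1 * layerSize k)        ≡⟨ ∑-cong (upTo N) (λ k → *-identityˡ (layerSize k)) ⟩
    ∑ (upTo N) layerSize ∎
    where
    open ≡-Reasoning
    L = allSubsets n

  cardAtLeast≡∑layerSize : ∀ {N} t → n < N → cardAtLeast 𝓔? t ≡ ∑ (upTo N) (λ k → 𝟙 (t ≤ᵇ k) * layerSize k)
  cardAtLeast≡∑layerSize {N} t n<N = begin
    cardAtLeast 𝓔? t                            ≡⟨ length-filter (λ p → 𝓔? p ×-dec (t ≤? ∣ p ∣)) L ⟩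
    ∑ L (λ p → 𝟙 (does (𝓔? p) ∧ (t ≤ᵇ ∣ p ∣)))   ≡⟨ ∑-cong L (λ p → trans (𝟙-∧ (does (𝓔? p)) _) (*-comm (χ p) _)) ⟩
    ∑ L (λ p → 𝟙 (t ≤ᵇ ∣ p ∣) * χ p)             ≡⟨ ∑-by-size N χ (λ k → 𝟙 (t ≤ᵇ k)) n<N ⟩
    ∑ (upTo N) (λ k → 𝟙 (t ≤ᵇ k) * layerSize k) ∎
    where
    open ≡-Reasoning
    L = allSubsets n

binomTail≡∑ : ∀ {r N} t → r < N → binomTail r t ≡ ∑ (upTo N) (λ k → 𝟙 (t ≤ᵇ k) * (r C k))
binomTail≡∑ {r} t r<N = trans (∑-filter (t ≤?_) (upTo (suc r)) (r C_))
  (sym (∑-upTo-vanishing (λ k → 𝟙 (t ≤ᵇ k) * (r C k))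
         (λ k r<k → trans (cong (𝟙 (t ≤ᵇ k) *_) (k>n⇒nCk≡0 r<k)) (*-zeroʳ (𝟙 (t ≤ᵇ k)))) r<N))

lemma17 : (n : ℕ) (𝓔 : Pred (Subset n) 0ℓ) (𝓔? : Decidable 𝓔) (r : ℕ) →
    ∃ 𝓔 → DownClosed 𝓔 → (∀ A → Maximal 𝓔 A → r ≤ ∣ A ∣) →
    ∀ (t : ℕ) → card 𝓔? * binomTail r t ≤ cardAtLeast 𝓔? t * 2 ^ r
lemma17 n 𝓔 𝓔? r _ down maximal-large t = begin
  card 𝓔? * binomTail r t
    ≡⟨ cong₂ _*_ (card≡∑layerSize n<N) (binomTail≡∑ t r<N) ⟩
  ∑ R layerSize * ∑ R (λ k → 𝟙 (t ≤ᵇ k) * (r C k))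
    ≤⟨ tail-comparison layerSize (r C_) (ratio-mono r layerSize (layerSize-step maximal-large)) t R ⟩
  ∑ R (λ k → 𝟙 (t ≤ᵇ k) * layerSize k) * ∑ R (r C_)
    ≡⟨ cong₂ _*_ (sym (cardAtLeast≡∑layerSize t n<N)) (∑-binomial r<N) ⟩
  cardAtLeast 𝓔? t * 2 ^ r ∎
  where
  open ≤-Reasoning
  open DownClosedFamily 𝓔? down
  N = suc (n + r)
  R = upTo N
  n<N : n < N
  n<N = s≤s (m≤m+n n r)
  r<N : r < N
  r<N = s≤s (m≤n+m r n)
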